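{- Consider the set of all finite and infinite tournament sequences and the set of all finite and infinite Meeussen sequences, each viewed as a rooted tree: the root is the sequence $(1)$ of length $1$, the nodes at level $n$ are the sequences of length $n$, and the parent of $(s_1,\ldots,s_n)$ is $(s_1,\ldots,s_{n-1})$ (infinite sequences correspond to infinite paths from the root). There is a unique isomorphism $\phi$ of rooted trees from the tree of tournament sequences to the tree of Meeussen sequences; it extends to a bijection between infinite tournament sequences and infinite Meeussen sequences, preserves the length of sequences, and respects the lexicographic ordering on sequences of each type.
   Context: A tournament sequence is an increasing sequence of positive integers $(t_1,t_2,\ldots)$ (finite or infinite) with $t_1=1$ and $t_i<t_{i+1}\leq 2t_i$ for all $i$. For an integer sequence $A$, $r(A)$ is the set of sums of subsets (by index) of the terms of $A$, including $0$, and $ur(A)$ is the set of integers that are such a sum for exactly one subset of indices. An infinite Meeussen sequence is an infinite sequence of positive integers $M=(m_1,m_2,\ldots)$ with $m_1=1$, $m_i<m_{i+1}$, every nonnegative integer in $r(M)$, and $m_i-1\in ur(M)$ for every $i$; a finite Meeussen sequence is an initial segment of an infinite one. -}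

module Defs where

open import Data.Nat using (ℕ; zero; suc; _+_; _*_; _∸_; _≤_; _<_)
open import Data.Nat.ListAction using (sum)
open import Data.List using (List; []; _∷_; map; upTo; length; _++_; [_])
open import Data.Product using (Σ; _×_; _,_)
open import Data.Unit using (⊤)
open import Data.Empty using (⊥)
open import Relation.Binary.PropositionalEquality using (_≡_)

-- Finite sequences are lists (t₁ , … , tₙ) stored with index 0 = t₁.
-- Infinite sequences are functions ℕ → ℕ with index 0 = first term.

prefix : (ℕ → ℕ) → ℕ → List ℕ
prefix m n = map m (upTo n)

TChain : ℕ → List ℕ → Set
TChain a []      = ⊤
TChain a (b ∷ l) = (a < b) × (b ≤ 2 * a) × TChain b l

IsTournament : List ℕ → Set
IsTournament []      = ⊥
IsTournament (a ∷ l) = (a ≡ 1) × TChain a l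

IsTournamentInf : (ℕ → ℕ) → Set
IsTournamentInf t = (t 0 ≡ 1) × (∀ i → (t i < t (suc i)) × (t (suc i) ≤ 2 * t i))

-- Subset sums. A finite set of indices is represented canonically as a
-- strictly increasing list of indices.

StrictIncrFrom : ℕ → List ℕ → Set
StrictIncrFrom a []      = ⊤
StrictIncrFrom a (b ∷ l) = (a < b) × StrictIncrFrom b l

StrictIncr : List ℕ → Set
StrictIncr []      = ⊤
StrictIncr (a ∷ l) = StrictIncrFrom a l

subsetSum : (ℕ → ℕ) → List ℕ → ℕ
subsetSum m I = sum (map m I)

InR : (ℕ → ℕ) → ℕ → Set
InR m n = Σ (List ℕ) λ I → StrictIncr I × (subsetSum m I ≡ n)

InUR : (ℕ → ℕ) → ℕ → Set
InUR m n = Σ (List ℕ) λ I → StrictIncr I × (subsetSum m I ≡ n)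
             × (∀ J → StrictIncr J → subsetSum m J ≡ n → J ≡ I)

IsMeeussenInf : (ℕ → ℕ) → Set
IsMeeussenInf m = (m 0 ≡ 1)
                × (∀ i → m i < m (suc i))
                × (∀ n → InR m n)
                × (∀ i → InUR m (m i ∸ 1))

IsMeeussen : List ℕ → Set
IsMeeussen s = (1 ≤ length s) × Σ (ℕ → ℕ) λ m → IsMeeussenInf m × (s ≡ prefix m (length s))

data _<lex_ : List ℕ → List ℕ → Set where
  []<∷  : ∀ {y l} → [] <lex (y ∷ l)
  head< : ∀ {x y l l'} → x < y → (x ∷ l) <lex (y ∷ l')
  tail< : ∀ {x l l'} → l <lex l' → (x ∷ l) <lex (x ∷ l')

LexInf : (ℕ → ℕ) → (ℕ → ℕ) → Set
LexInf t t' = Σ ℕ λ k → (∀ i → i < k → t i ≡ t' i) × (t k < t' k)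

_⟺_ : Set → Set → Set
A ⟺ B = (A → B) × (B → A)

-- Rooted-tree isomorphism between the tree of finite tournament sequences
-- and the tree of finite Meeussen sequences (root (1), parent = drop last
-- term), given as a map on lists.

record IsTreeIso (φ : List ℕ → List ℕ) : Set where
  field
    maps   : ∀ s → IsTournament s → IsMeeussen (φ s)
    inj    : ∀ s t → IsTournament s → IsTournament t → φ s ≡ φ t → s ≡ t
    surj   : ∀ m → IsMeeussen m → Σ (List ℕ) λ s → IsTournament s × (φ s ≡ m)
    root   : φ [ 1 ] ≡ [ 1 ]
    parent : ∀ s x → IsTournament (s ++ [ x ]) → 1 ≤ length s →
             Σ ℕ λ y → φ (s ++ [ x ]) ≡ φ s ++ [ y ]

record IsInfExtension (φ : List ℕ → List ℕ) (Φ : (ℕ → ℕ) → (ℕ → ℕ)) : Set where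
  field
    maps   : ∀ t → IsTournamentInf t → IsMeeussenInf (Φ t)
    agrees : ∀ t → IsTournamentInf t → ∀ n → prefix (Φ t) (suc n) ≡ φ (prefix t (suc n))
    inj    : ∀ t t' → IsTournamentInf t → IsTournamentInf t' →
             (∀ i → Φ t i ≡ Φ t' i) → ∀ i → t i ≡ t' i
    surj   : ∀ m → IsMeeussenInf m →
             Σ (ℕ → ℕ) λ t → IsTournamentInf t × (∀ i → Φ t i ≡ m i)
    lex    : ∀ t t' → IsTournamentInf t → IsTournamentInf t' →
             LexInf t t' ⟺ LexInf (Φ t) (Φ t')

{-# OPTIONS --safe #-}
-- For a finite Meeussen sequence w let degree w be the number of uniquely representable
-- subset sums of w below its last term. Subset sums are symmetric about sum w / 2, and every
-- value from the last term up to the sum is represented both with and without the last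
-- term, so exactly 2 * degree w values in [0, sum w] are uniquely representable. Hence w has
-- degree w children w ++ [ suc j ] (j at least the last term and uniquely representable),
-- and counting the unique values up to j maps them increasingly onto (degree w, 2 * degree w],
-- which are the children of a tournament node with last term degree w. Following this
-- matching term by term gives an order-preserving tree isomorphism φ with degree ∘ φ = last.
-- It is the only one: tree isomorphisms preserve numbers of children, and the children of a
-- Meeussen node have pairwise distinct degrees. Infinite sequences are handled prefix by prefix.
module Submission where

open import Defs
open import Data.Bool using (if_then_else_)
open import Data.Empty using (⊥-elim)
open import Data.Fin using (Fin; toℕ; fromℕ<)
open import Data.Fin.Properties using (injective⇒≤; toℕ-injective; toℕ<n; toℕ-fromℕ<)
open import Data.List using (List; []; _∷_; [_]; _++_; length; map; upTo; take; drop)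
open import Data.List.Properties
  using (∷-injective; ∷ʳ-injective; ∷ʳ-injectiveˡ; ∷ʳ-injectiveʳ; ++-assoc; ++-identityʳ; ++-conicalˡ; ++-conicalʳ;
         length-++; map-∘; map-++; map-injective; map-upTo; map-applyUpTo; upTo-∷ʳ; take-all; take++drop≡id)
open import Data.List.Relation.Unary.All using (All; []; _∷_)
import Data.List.Relation.Unary.All as All
open import Data.List.Relation.Unary.All.Properties using (map⁺; map⁻)
open import Data.List.Reverse using (Reverse; reverseView; []; _∶_∶ʳ_)
open import Data.Nat using (ℕ; zero; suc; _+_; _*_; _∸_; _≤_; _<_; _≤?_; _<?_; _≟_; z≤n; s≤s; s≤s⁻¹)
open import Data.Nat.ListAction using (sum)
open import Data.Nat.ListAction.Properties using (sum-++)
open import Data.Nat.Properties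
open import Data.Product using (Σ; _×_; _,_; proj₁; proj₂)
open import Data.Sum using (_⊎_; inj₁; inj₂)
open import Function using (_∘_)
open import Level using (0ℓ)
open import Relation.Binary.Definitions using (tri<; tri≈; tri>)
open import Relation.Binary.PropositionalEquality hiding ([_])
open import Relation.Nullary using (¬_; yes; no; does)
open import Relation.Unary using (Pred; Decidable)
open import Algebra.Properties.CommutativeSemigroup +-commutativeSemigroup using (interchange)

lastOr : ℕ → List ℕ → ℕ
lastOr a []      = a
lastOr a (b ∷ l) = lastOr b l

last : List ℕ → ℕ
last = lastOr 0

lastOr-∷ʳ : ∀ a l x → lastOr a (l ++ [ x ]) ≡ x
lastOr-∷ʳ a []      x = refl
lastOr-∷ʳ a (b ∷ l) x = lastOr-∷ʳ b l x

last-∷ʳ : ∀ l x → last (l ++ [ x ]) ≡ x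
last-∷ʳ = lastOr-∷ʳ 0

∷ʳ≢[] : ∀ (l : List ℕ) x → l ++ [ x ] ≢ []
∷ʳ≢[] l x eq with ++-conicalʳ l [ x ] eq
... | ()

sum-∷ʳ : ∀ l x → sum (l ++ [ x ]) ≡ sum l + x
sum-∷ʳ l x = trans (sum-++ l [ x ]) (cong (sum l +_) (+-identityʳ x))

length-∷ʳ : ∀ (l : List ℕ) x → length (l ++ [ x ]) ≡ suc (length l)
length-∷ʳ l x = trans (length-++ l) (+-comm (length l) 1)

nonempty⇒1≤length : ∀ {l : List ℕ} → l ≢ [] → 1 ≤ length l
nonempty⇒1≤length {[]}    l≢[] = ⊥-elim (l≢[] refl)
nonempty⇒1≤length {_ ∷ _} _    = s≤s z≤n

prefix-suc : ∀ m n → prefix m (suc n) ≡ m 0 ∷ prefix (m ∘ suc) n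
prefix-suc m n = cong (m 0 ∷_) (trans (map-applyUpTo suc m n) (sym (map-upTo (m ∘ suc) n)))

prefix-∷ʳ : ∀ m n → prefix m (suc n) ≡ prefix m n ++ [ m n ]
prefix-∷ʳ m n = trans (cong (map m) (sym (upTo-∷ʳ n))) (map-++ m (upTo n) [ n ])

last-prefix : ∀ m n → last (prefix m (suc n)) ≡ m n
last-prefix m n = trans (cong last (prefix-∷ʳ m n)) (last-∷ʳ (prefix m n) (m n))

prefix-cong : ∀ {m m′} n → (∀ i → i < n → m i ≡ m′ i) → prefix m n ≡ prefix m′ n
prefix-cong {m} {m′} zero    _  = refl
prefix-cong {m} {m′} (suc n) eq = begin
  prefix m (suc n)              ≡⟨ prefix-suc m n ⟩
  m 0 ∷ prefix (m ∘ suc) n      ≡⟨ cong₂ _∷_ (eq 0 (s≤s z≤n)) (prefix-cong n λ i i<n → eq (suc i) (s≤s i<n)) ⟩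
  m′ 0 ∷ prefix (m′ ∘ suc) n    ≡⟨ prefix-suc m′ n ⟨
  prefix m′ (suc n)             ∎
  where open ≡-Reasoning

prefix-suc≢[] : ∀ m n → prefix m (suc n) ≢ []
prefix-suc≢[] m n eq with trans (sym (prefix-suc m n)) eq
... | ()

at : List ℕ → ℕ → ℕ
at []      _       = 0
at (a ∷ l) zero    = a
at (a ∷ l) (suc i) = at l i

at-++ : ∀ l u {i} → i < length l → at (l ++ u) i ≡ at l i
at-++ (a ∷ l) u {zero}  _         = refl
at-++ (a ∷ l) u {suc i} (s≤s i<n) = at-++ l u i<n

prefix-take : ∀ {m} n E → n ≤ length E → (∀ i → i < n → m i ≡ at E i) → prefix m n ≡ take n E
prefix-take         zero    E       _         _  = refl
prefix-take {m} (suc n) (a ∷ E) (s≤s n≤len) eq = trans (prefix-suc m n)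
  (cong₂ _∷_ (eq 0 (s≤s z≤n)) (prefix-take n E n≤len (λ i i<n → eq (suc i) (s≤s i<n))))

∷-<lex⁻ : ∀ {a b l l′} → (a ∷ l) <lex (b ∷ l′) → (a < b) ⊎ ((a ≡ b) × (l <lex l′))
∷-<lex⁻ (head< a<b) = inj₁ a<b
∷-<lex⁻ (tail< l<l′) = inj₂ (refl , l<l′)

++-<lex : ∀ p {x y l l′} → x < y → (p ++ x ∷ l) <lex (p ++ y ∷ l′)
++-<lex []      x<y = head< x<y
++-<lex (a ∷ p) x<y = tail< (++-<lex p x<y)

LexInf⇒prefix-<lex : ∀ {t t′} → LexInf t t′ → Σ ℕ λ n → prefix t (suc n) <lex prefix t′ (suc n)
LexInf⇒prefix-<lex {t} {t′} (k , agree , lt) = k , subst₂ _<lex_ (sym (prefix-∷ʳ t k)) (sym (prefix-∷ʳ t′ k))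
  (subst (λ p → (prefix t k ++ [ t k ]) <lex (p ++ [ t′ k ])) (prefix-cong k agree) (++-<lex (prefix t k) lt))

prefix-<lex⇒LexInf : ∀ {t t′} n → prefix t n <lex prefix t′ n → LexInf t t′
prefix-<lex⇒LexInf {t} {t′} (suc n) lt
  with ∷-<lex⁻ (subst₂ _<lex_ (prefix-suc t n) (prefix-suc t′ n) lt)
... | inj₁ t0<t′0 = 0 , (λ _ ()) , t0<t′0
... | inj₂ (t0≡t′0 , lt′) with prefix-<lex⇒LexInf n lt′
...   | k , agree , tk<t′k = suc k , agree′ , tk<t′k
  where
  agree′ : ∀ i → i < suc k → t i ≡ t′ i
  agree′ zero    _         = t0≡t′0
  agree′ (suc i) (s≤s i<k) = agree i i<k

count : {P : Pred ℕ 0ℓ} → Decidable P → ℕ → ℕ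
count P? zero    = 0
count P? (suc n) = if does (P? n) then suc (count P? n) else count P? n

module _ {P : Pred ℕ 0ℓ} (P? : Decidable P) where

  count-yes : ∀ {n} → P n → count P? (suc n) ≡ suc (count P? n)
  count-yes {n} p with P? n
  ... | yes _ = refl
  ... | no ¬p = ⊥-elim (¬p p)

  count-no : ∀ {n} → ¬ P n → count P? (suc n) ≡ count P? n
  count-no {n} ¬p with P? n
  ... | yes p = ⊥-elim (¬p p)
  ... | no _  = refl

  count-step : ∀ n → count P? n ≤ count P? (suc n) × count P? (suc n) ≤ suc (count P? n)
  count-step n with P? n
  ... | yes _ = n≤1+n _ , ≤-refl
  ... | no _  = ≤-refl , n≤1+n _

  count-mono : ∀ {m n} → m ≤ n → count P? m ≤ count P? n
  count-mono {n = zero}  z≤n = ≤-refl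
  count-mono {n = suc n} m≤1+n with m≤n⇒m<n∨m≡n m≤1+n
  ... | inj₁ m<1+n = ≤-trans (count-mono (≤-pred m<1+n)) (proj₁ (count-step n))
  ... | inj₂ refl  = ≤-refl

  count-increase : ∀ {n} → count P? n < count P? (suc n) → P n
  count-increase {n} grows with P? n
  ... | yes p = p
  ... | no _  = ⊥-elim (<-irrefl refl grows)

  count-none : ∀ n → (∀ i → i < n → ¬ P i) → count P? n ≡ 0
  count-none zero    _    = refl
  count-none (suc n) none =
    trans (count-no (none n ≤-refl)) (count-none n (λ i i<n → none i (m<n⇒m<1+n i<n)))

count-+ : ∀ {P : Pred ℕ 0ℓ} (P? : Decidable P) m n →
          count P? (m + n) ≡ count P? m + count (λ i → P? (m + i)) n
count-+ P? m zero    = trans (cong (count P?) (+-identityʳ m)) (sym (+-identityʳ _))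
count-+ P? m (suc n) rewrite +-suc m n with P? (m + n)
... | yes _ = trans (cong suc (count-+ P? m n)) (sym (+-suc _ _))
... | no _  = count-+ P? m n

count-cong : ∀ {P Q : Pred ℕ 0ℓ} (P? : Decidable P) (Q? : Decidable Q) n →
             (∀ i → i < n → P i ⟺ Q i) → count P? n ≡ count Q? n
count-cong P? Q? zero    _   = refl
count-cong P? Q? (suc n) P⇔Q with P? n | Q? n | count-cong P? Q? n (λ i i<n → P⇔Q i (m<n⇒m<1+n i<n))
... | yes _ | yes _ | eq = cong suc eq
... | no _  | no _  | eq = eq
... | yes p | no ¬q | _  = ⊥-elim (¬q (proj₁ (P⇔Q n ≤-refl) p))
... | no ¬p | yes q | _  = ⊥-elim (¬p (proj₂ (P⇔Q n ≤-refl) q))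

count-reverse : ∀ {P Q : Pred ℕ 0ℓ} (P? : Decidable P) (Q? : Decidable Q) n →
                (∀ i j → suc (i + j) ≡ n → P i ⟺ Q j) → count P? n ≡ count Q? n
count-reverse P? Q? zero    _    = refl
count-reverse P? Q? (suc n) dual = begin
  count P? (suc n)                              ≡⟨ cong (count P?) (+-comm 1 n) ⟩
  count P? (n + 1)                              ≡⟨ count-+ P? n 1 ⟩
  count P? n + count (λ i → P? (n + i)) 1       ≡⟨ cong₂ _+_ inner outer ⟩
  count (λ j → Q? (suc j)) n + count Q? 1       ≡⟨ +-comm _ (count Q? 1) ⟩
  count Q? 1 + count (λ j → Q? (1 + j)) n       ≡⟨ count-+ Q? 1 n ⟨
  count Q? (suc n)                              ∎
  where
  open ≡-Reasoning
  inner = count-reverse P? (λ j → Q? (suc j)) n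
            (λ i j e → dual i (suc j) (trans (cong suc (+-suc i j)) (cong suc e)))
  outer = count-cong (λ i → P? (n + i)) Q? 1
            λ { zero _ → dual (n + 0) 0 (cong suc (trans (+-identityʳ _) (+-identityʳ n)))
              ; (suc _) (s≤s ()) }

bounded-injection⇒≤ : ∀ {a b} (f : ∀ i → i < a → ℕ) → (∀ i i<a → f i i<a < b) →
                      (∀ {i i′} i<a i′<a → f i i<a ≡ f i′ i′<a → i ≡ i′) → a ≤ b
bounded-injection⇒≤ {a} {b} f f<b f-inj = injective⇒≤ {f = g} g-injective
  where
  g : Fin a → Fin b
  g i = fromℕ< (f<b (toℕ i) (toℕ<n i))
  g-injective : ∀ {i i′} → g i ≡ g i′ → i ≡ i′
  g-injective {i} {i′} eq = toℕ-injective (f-inj (toℕ<n i) (toℕ<n i′)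
    (trans (sym (toℕ-fromℕ< (f<b _ (toℕ<n i)))) (trans (cong toℕ eq) (toℕ-fromℕ< (f<b _ (toℕ<n i′))))))

correspondence⇒≡ : ∀ {a b} (R : ℕ → ℕ → Set) →
                   (∀ {i} → i < a → Σ ℕ λ k → (k < b) × R i k) →
                   (∀ {k} → k < b → Σ ℕ λ i → (i < a) × R i k) →
                   (∀ {i i′ k} → i < a → i′ < a → R i k → R i′ k → i ≡ i′) →
                   (∀ {i k k′} → k < b → k′ < b → R i k → R i k′ → k ≡ k′) → a ≡ b
correspondence⇒≡ R image preimage unique-i unique-k = ≤-antisym
  (bounded-injection⇒≤ (λ _ i<a → proj₁ (image i<a)) (λ _ i<a → proj₁ (proj₂ (image i<a)))
    λ i<a i′<a eq → unique-i i<a i′<a (proj₂ (proj₂ (image i<a)))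
                                      (subst (R _) (sym eq) (proj₂ (proj₂ (image i′<a)))))
  (bounded-injection⇒≤ (λ _ k<b → proj₁ (preimage k<b)) (λ _ k<b → proj₁ (proj₂ (preimage k<b)))
    λ k<b k′<b eq → unique-k k<b k′<b (proj₂ (proj₂ (preimage k<b)))
                                      (subst (λ i → R i _) (sym eq) (proj₂ (proj₂ (preimage k′<b)))))

Least : (ℕ → ℕ) → ℕ → ℕ → Set
Least f x k = (x ≤ f k) × (∀ i → i < k → f i < x)

least-unique : ∀ {f x k k′} → Least f x k → Least f x k′ → k ≡ k′
least-unique {k = k} {k′} (x≤fk , below) (x≤fk′ , below′) with <-cmp k k′
... | tri< k<k′ _ _ = ⊥-elim (<⇒≱ (below′ k k<k′) x≤fk)
... | tri≈ _ k≡k′ _ = k≡k′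
... | tri> _ _ k′<k = ⊥-elim (<⇒≱ (below k′ k′<k) x≤fk′)

search : (ℕ → ℕ) → ℕ → ℕ → ℕ → ℕ
search f x k zero    = k
search f x k (suc n) with x ≤? f k
... | yes _ = k
... | no  _ = search f x (suc k) n

search-least : ∀ f x k n → (∀ i → i < k → f i < x) → x ≤ f (k + n) → Least f x (search f x k n)
search-least f x k zero    below x≤f = subst (λ i → x ≤ f i) (+-identityʳ k) x≤f , below
search-least f x k (suc n) below x≤f with x ≤? f k
... | yes x≤fk = x≤fk , below
... | no  x≰fk = search-least f x (suc k) n below′ (subst (λ i → x ≤ f i) (+-suc k n) x≤f)
  where
  below′ : ∀ i → i < suc k → f i < x
  below′ i i<1+k with m≤n⇒m<n∨m≡n (≤-pred i<1+k)
  ... | inj₁ i<k  = below i i<k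
  ... | inj₂ refl = ≰⇒> x≰fk

-- Subset-sum counts

shift : ℕ → (ℕ → ℕ) → ℕ → ℕ
shift zero    f j       = f j
shift (suc a) f zero    = 0
shift (suc a) f (suc j) = shift a f j

shift-+ : ∀ a f d → shift a f (a + d) ≡ f d
shift-+ zero    f d = refl
shift-+ (suc a) f d = shift-+ a f d

shift-< : ∀ a f {j} → j < a → shift a f j ≡ 0
shift-< (suc a) f {zero}  _       = refl
shift-< (suc a) f {suc j} (s≤s p) = shift-< a f p

shift-cong : ∀ a {f g : ℕ → ℕ} → (∀ j → f j ≡ g j) → ∀ j → shift a f j ≡ shift a g j
shift-cong zero    f≗g j       = f≗g j
shift-cong (suc a) f≗g zero    = refl
shift-cong (suc a) f≗g (suc j) = shift-cong a f≗g j

shift-distrib-+ : ∀ a f g j → shift a (λ i → f i + g i) j ≡ shift a f j + shift a g j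
shift-distrib-+ zero    f g j       = refl
shift-distrib-+ (suc a) f g zero    = refl
shift-distrib-+ (suc a) f g (suc j) = shift-distrib-+ a f g j

shift-shift : ∀ a b f j → shift a (shift b f) j ≡ shift (a + b) f j
shift-shift zero    b f j       = refl
shift-shift (suc a) b f zero    = refl
shift-shift (suc a) b f (suc j) = shift-shift a b f j

shift-comm : ∀ a b f j → shift a (shift b f) j ≡ shift b (shift a f) j
shift-comm a b f j = begin
  shift a (shift b f) j  ≡⟨ shift-shift a b f j ⟩
  shift (a + b) f j      ≡⟨ cong (λ c → shift c f j) (+-comm a b) ⟩
  shift (b + a) f j      ≡⟨ shift-shift b a f j ⟨
  shift b (shift a f) j  ∎
  where open ≡-Reasoning

shift-pos : ∀ a f {c j} → c < shift a f j → Σ ℕ λ d → (j ≡ a + d) × (c < f d)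
shift-pos zero    f {j = j}     c<f = j , refl , c<f
shift-pos (suc a) f {j = suc j} c<f with shift-pos a f c<f
... | d , refl , c<fd = d , refl , c<fd

-- sumCount l j is the coefficient of x ^ j in the product of the (1 + x ^ a) over the entries a of l.
sumCount : List ℕ → ℕ → ℕ
sumCount []      zero    = 1
sumCount []      (suc _) = 0
sumCount (a ∷ l) j       = sumCount l j + shift a (sumCount l) j

sumCount-swap : ∀ a b l j → sumCount (a ∷ b ∷ l) j ≡ sumCount (b ∷ a ∷ l) j
sumCount-swap a b l j = begin
  (C j + shift b C j) + shift a (λ i → C i + shift b C i) j
    ≡⟨ cong (C j + shift b C j +_) (shift-distrib-+ a C (shift b C) j) ⟩
  (C j + shift b C j) + (shift a C j + shift a (shift b C) j)
    ≡⟨ interchange (C j) _ _ _ ⟩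
  (C j + shift a C j) + (shift b C j + shift a (shift b C) j)
    ≡⟨ cong (λ z → C j + shift a C j + (shift b C j + z)) (shift-comm a b C j) ⟩
  (C j + shift a C j) + (shift b C j + shift b (shift a C) j)
    ≡⟨ cong (C j + shift a C j +_) (shift-distrib-+ b C (shift a C) j) ⟨
  (C j + shift a C j) + shift b (λ i → C i + shift a C i) j
    ∎
  where
  open ≡-Reasoning
  C = sumCount l

sumCount-∷ʳ : ∀ l a j → sumCount (l ++ [ a ]) j ≡ sumCount l j + shift a (sumCount l) j
sumCount-∷ʳ []      a j = refl
sumCount-∷ʳ (b ∷ l) a j =
  trans (cong₂ _+_ (sumCount-∷ʳ l a j) (shift-cong b (sumCount-∷ʳ l a) j)) (sumCount-swap b a l j)

sumCount->sum : ∀ l {j} → sum l < j → sumCount l j ≡ 0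
sumCount->sum []      {suc j} _     = refl
sumCount->sum (a ∷ l) {j}     a+s<j = cong₂ _+_ (sumCount->sum l (≤-<-trans (m≤n+m _ a) a+s<j)) shifted
  where
  shifted : shift a (sumCount l) j ≡ 0
  shifted with a ≤? j
  ... | no a≰j = shift-< a _ (≰⇒> a≰j)
  ... | yes a≤j with m≤n⇒∃[o]m+o≡n a≤j
  ...   | d , refl = trans (shift-+ a _ d) (sumCount->sum l (+-cancelˡ-< a _ _ a+s<j))

sumCount-pos⇒≤sum : ∀ l {j} → 0 < sumCount l j → j ≤ sum l
sumCount-pos⇒≤sum l {j} pos with j ≤? sum l
... | yes j≤s = j≤s
... | no  j≰s = ⊥-elim (<-irrefl (sym (sumCount->sum l (≰⇒> j≰s))) pos)

-- The complement of a representation of j is a representation of sum l ∸ j.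
sumCount-sym : ∀ l {j k} → j + k ≡ sum l → sumCount l j ≡ sumCount l k
sumCount-sym []      {zero}  {zero} _  = refl
sumCount-sym (a ∷ l) {j}     {k}    eq = begin
  C j + shift a C j   ≡⟨ cong₂ _+_ (reflect eq) (sym (reflect (trans (+-comm k j) eq))) ⟩
  shift a C k + C k   ≡⟨ +-comm _ (C k) ⟩
  C k + shift a C k   ∎
  where
  open ≡-Reasoning
  C = sumCount l
  reflect : ∀ {j k} → j + k ≡ a + sum l → C j ≡ shift a C k
  reflect {j} {k} eq with a ≤? k
  ... | no a≰k = trans (sumCount->sum l s<j) (sym (shift-< a C (≰⇒> a≰k)))
    where
    s<j : sum l < j
    s<j = +-cancelʳ-< k (sum l) j (subst (sum l + k <_) (trans (+-comm (sum l) a) (sym eq))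
                                      (+-monoʳ-< (sum l) (≰⇒> a≰k)))
  ... | yes a≤k with m≤n⇒∃[o]m+o≡n a≤k
  ...   | d , refl = trans (sumCount-sym l (+-cancelˡ-≡ a _ _ eq')) (sym (shift-+ a C d))
    where
    eq' : a + (j + d) ≡ a + sum l
    eq' = trans (trans (sym (+-assoc a j d)) (trans (cong (_+ d) (+-comm a j)) (+-assoc j a d))) eq

Rep : (ℕ → ℕ) → ℕ → ℕ → List ℕ → Set
Rep m K j I = StrictIncr I × All (_< K) I × (subsetSum m I ≡ j)

strictIncrFrom-map-suc : ∀ {a} l → StrictIncrFrom a l → StrictIncrFrom (suc a) (map suc l)
strictIncrFrom-map-suc []      _          = _
strictIncrFrom-map-suc (b ∷ l) (a<b , si) = s≤s a<b , strictIncrFrom-map-suc l si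

strictIncrFrom-map-suc⁻ : ∀ {a} l → StrictIncrFrom (suc a) (map suc l) → StrictIncrFrom a l
strictIncrFrom-map-suc⁻ []      _          = _
strictIncrFrom-map-suc⁻ (b ∷ l) (a<b , si) = s≤s⁻¹ a<b , strictIncrFrom-map-suc⁻ l si

strictIncrFrom-positive : ∀ {a} l → StrictIncrFrom a l → Σ (List ℕ) λ l′ → l ≡ map suc l′
strictIncrFrom-positive []            _        = [] , refl
strictIncrFrom-positive (suc b ∷ l) (_ , si) with strictIncrFrom-positive l si
... | l′ , refl = b ∷ l′ , refl

strictIncr-map-suc : ∀ I → StrictIncr I → StrictIncr (map suc I)
strictIncr-map-suc []      _  = _
strictIncr-map-suc (a ∷ I) si = strictIncrFrom-map-suc I si

strictIncr-0∷map-suc : ∀ I → StrictIncr I → StrictIncrFrom 0 (map suc I)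
strictIncr-0∷map-suc []      _  = _
strictIncr-0∷map-suc (a ∷ I) si = s≤s z≤n , strictIncrFrom-map-suc I si

strictIncr-0∷map-suc⁻ : ∀ I → StrictIncrFrom 0 (map suc I) → StrictIncr I
strictIncr-0∷map-suc⁻ []      _        = _
strictIncr-0∷map-suc⁻ (a ∷ I) (_ , si) = strictIncrFrom-map-suc⁻ I si

subsetSum-map-suc : ∀ m I → subsetSum m (map suc I) ≡ subsetSum (m ∘ suc) I
subsetSum-map-suc m I = cong sum (sym (map-∘ I))

data RepView (m : ℕ → ℕ) (K j : ℕ) : List ℕ → Set where
  omit : ∀ {I} → Rep (m ∘ suc) K j I → RepView m K j (map suc I)
  include : ∀ {I} d → j ≡ m 0 + d → Rep (m ∘ suc) K d I → RepView m K j (0 ∷ map suc I)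

repView : ∀ {m K j} I → Rep m (suc K) j I → RepView m K j I
repView {m} [] (_ , [] , sum≡) = omit {I = []} (_ , [] , sum≡)
repView {m} (zero ∷ l) (si , _ ∷ bound , sum≡) with strictIncrFrom-positive l si
... | I , refl = include (subsetSum (m ∘ suc) I) (trans (sym sum≡) (cong (m 0 +_) (subsetSum-map-suc m I)))
                   (strictIncr-0∷map-suc⁻ I si , All.map s≤s⁻¹ (map⁻ bound) , refl)
repView {m} (suc x ∷ l) (si , bound , sum≡) with strictIncrFrom-positive l si
... | I , refl = omit (strictIncrFrom-map-suc⁻ I si , All.map s≤s⁻¹ (map⁻ bound) ,
                       trans (sym (subsetSum-map-suc m (x ∷ I))) sum≡)

rep-omit : ∀ {m K j} I → Rep (m ∘ suc) K j I → Rep m (suc K) j (map suc I)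
rep-omit {m} I (si , bound , sum≡) =
  strictIncr-map-suc I si , map⁺ (All.map s≤s bound) , trans (subsetSum-map-suc m I) sum≡

rep-include : ∀ {m K d} I → Rep (m ∘ suc) K d I → Rep m (suc K) (m 0 + d) (0 ∷ map suc I)
rep-include {m} I (si , bound , sum≡) =
  strictIncr-0∷map-suc I si , s≤s z≤n ∷ map⁺ (All.map s≤s bound) ,
  cong (m 0 +_) (trans (subsetSum-map-suc m I) sum≡)

sumCount-prefix-suc : ∀ m K j → sumCount (prefix m (suc K)) j
                      ≡ sumCount (prefix (m ∘ suc) K) j + shift (m 0) (sumCount (prefix (m ∘ suc) K)) j
sumCount-prefix-suc m K j = cong (λ l → sumCount l j) (prefix-suc m K)

rep⇒sumCount-pos : ∀ K m {j} I → Rep m K j I → 0 < sumCount (prefix m K) j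
rep⇒sumCount-pos zero    m []      (_ , [] , refl)    = s≤s z≤n
rep⇒sumCount-pos zero    m (_ ∷ _) (_ , () ∷ _ , _)
rep⇒sumCount-pos (suc K) m {j} I r rewrite sumCount-prefix-suc m K j with repView I r
... | omit {I′} r′       = ≤-trans (rep⇒sumCount-pos K (m ∘ suc) I′ r′) (m≤m+n _ _)
... | include {I′} d refl r′ =
  ≤-trans (subst (0 <_) (sym (shift-+ (m 0) _ d)) (rep⇒sumCount-pos K (m ∘ suc) I′ r′)) (m≤n+m _ _)

+-pos⁻ : ∀ a b → 0 < a + b → (0 < a) ⊎ (0 < b)
+-pos⁻ zero    b pos = inj₂ pos
+-pos⁻ (suc a) b _   = inj₁ (s≤s z≤n)

sumCount-pos⇒rep : ∀ K m {j} → 0 < sumCount (prefix m K) j → Σ (List ℕ) (Rep m K j)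
sumCount-pos⇒rep zero    m {zero} _ = [] , _ , [] , refl
sumCount-pos⇒rep (suc K) m {j} pos rewrite sumCount-prefix-suc m K j with +-pos⁻ _ _ pos
... | inj₁ pos′ with sumCount-pos⇒rep K (m ∘ suc) pos′
...   | I , r = map suc I , rep-omit I r
sumCount-pos⇒rep (suc K) m {j} pos | inj₂ pos′ with shift-pos (m 0) _ pos′
... | d , refl , pos″ with sumCount-pos⇒rep K (m ∘ suc) pos″
...   | I , r = 0 ∷ map suc I , rep-include I r

omit-include⇒2≤sumCount : ∀ K m {d I J} → Rep (m ∘ suc) K (m 0 + d) I → Rep (m ∘ suc) K d J →
                          2 ≤ sumCount (prefix m (suc K)) (m 0 + d)
omit-include⇒2≤sumCount K m {d} {I} {J} rI rJ = subst (2 ≤_) (sym (sumCount-prefix-suc m K (m 0 + d)))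
  (+-mono-≤ (rep⇒sumCount-pos K (m ∘ suc) I rI)
            (subst (0 <_) (sym (shift-+ (m 0) _ d)) (rep⇒sumCount-pos K (m ∘ suc) J rJ)))

sumCount≤1⇒rep-unique : ∀ K m {j} I J → sumCount (prefix m K) j ≤ 1 → Rep m K j I → Rep m K j J → I ≡ J
sumCount≤1⇒rep-unique zero    m []      []      _ _               _               = refl
sumCount≤1⇒rep-unique zero    m (_ ∷ _) _       _ (_ , () ∷ _ , _) _
sumCount≤1⇒rep-unique zero    m _       (_ ∷ _) _ _               (_ , () ∷ _ , _)
sumCount≤1⇒rep-unique (suc K) m {j} I J ≤1 rI rJ with repView I rI | repView J rJ
... | omit {I′} r | omit {J′} r′ =
  cong (map suc) (sumCount≤1⇒rep-unique K (m ∘ suc) I′ J′ ≤1′ r r′)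
  where
  ≤1′ = ≤-trans (m≤m+n _ _) (≤-trans (≤-reflexive (sym (sumCount-prefix-suc m K j))) ≤1)
... | omit r | include d refl r′ = ⊥-elim (<⇒≱ (omit-include⇒2≤sumCount K m r r′) ≤1)
... | include d refl r | omit r′ = ⊥-elim (<⇒≱ (omit-include⇒2≤sumCount K m r′ r) ≤1)
... | include {I′} d refl r | include {J′} d′ eq r′ with +-cancelˡ-≡ (m 0) d d′ eq
...   | refl = cong (λ L → 0 ∷ map suc L) (sumCount≤1⇒rep-unique K (m ∘ suc) I′ J′ ≤1′ r r′)
  where
  ≤1′ = ≤-trans (≤-reflexive (sym (shift-+ (m 0) _ d)))
                (≤-trans (m≤n+m _ _) (≤-trans (≤-reflexive (sym (sumCount-prefix-suc m K j))) ≤1))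

+-≥2⁻ : ∀ a b → 2 ≤ a + b → (2 ≤ a) ⊎ (2 ≤ b) ⊎ ((0 < a) × (0 < b))
+-≥2⁻ zero                b         2≤ = inj₂ (inj₁ 2≤)
+-≥2⁻ (suc zero)          zero      (s≤s ())
+-≥2⁻ (suc zero)          (suc b)   _  = inj₂ (inj₂ (s≤s z≤n , s≤s z≤n))
+-≥2⁻ (suc (suc a))       b         _  = inj₁ (s≤s (s≤s z≤n))

map-suc≢0∷ : ∀ I J → map suc I ≢ 0 ∷ J
map-suc≢0∷ []      J ()
map-suc≢0∷ (_ ∷ _) J ()

DistinctReps : (ℕ → ℕ) → ℕ → ℕ → Set
DistinctReps m K j = Σ (List ℕ) λ I → Σ (List ℕ) λ J → Rep m K j I × Rep m K j J × (I ≢ J)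

2≤sumCount⇒distinct-reps : ∀ K m {j} → 2 ≤ sumCount (prefix m K) j → DistinctReps m K j
2≤sumCount⇒distinct-reps zero    m {zero} (s≤s ())
2≤sumCount⇒distinct-reps (suc K) m {j} 2≤ rewrite sumCount-prefix-suc m K j with +-≥2⁻ _ _ 2≤
... | inj₁ 2≤omit with 2≤sumCount⇒distinct-reps K (m ∘ suc) 2≤omit
...   | I , J , rI , rJ , I≢J =
  map suc I , map suc J , rep-omit I rI , rep-omit J rJ , I≢J ∘ map-injective suc-injective
2≤sumCount⇒distinct-reps (suc K) m {j} 2≤ | inj₂ (inj₁ 2≤include) with shift-pos (m 0) _ 2≤include
... | d , refl , 2≤′ with 2≤sumCount⇒distinct-reps K (m ∘ suc) 2≤′
...   | I , J , rI , rJ , I≢J =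
  0 ∷ map suc I , 0 ∷ map suc J , rep-include I rI , rep-include J rJ ,
  I≢J ∘ map-injective suc-injective ∘ proj₂ ∘ ∷-injective
2≤sumCount⇒distinct-reps (suc K) m {j} 2≤ | inj₂ (inj₂ (pos-omit , pos-include))
  with sumCount-pos⇒rep K (m ∘ suc) pos-omit | shift-pos (m 0) _ pos-include
... | I , rI | d , refl , pos′ with sumCount-pos⇒rep K (m ∘ suc) pos′
...   | J , rJ = map suc I , 0 ∷ map suc J , rep-omit I rI , rep-include J rJ , map-suc≢0∷ I (map suc J)

Increasing : (ℕ → ℕ) → Set
Increasing m = ∀ i → m i < m (suc i)

module _ {m : ℕ → ℕ} (incr : Increasing m) where

  increasing-mono : ∀ {i k} → i ≤ k → m i ≤ m k
  increasing-mono {i} i≤k with m≤n⇒∃[o]m+o≡n i≤k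
  ... | d , refl = go d
    where
    go : ∀ d → m i ≤ m (i + d)
    go zero    = ≤-reflexive (cong m (sym (+-identityʳ i)))
    go (suc d) = ≤-trans (go d) (≤-trans (<⇒≤ (incr (i + d))) (≤-reflexive (cong m (sym (+-suc i d)))))

  subsetSum<⇒indices< : ∀ K I → subsetSum m I < m K → All (_< K) I
  subsetSum<⇒indices< K []      _  = []
  subsetSum<⇒indices< K (x ∷ I) lt = x<K ∷ subsetSum<⇒indices< K I (≤-<-trans (m≤n+m _ (m x)) lt)
    where
    x<K : x < K
    x<K with x <? K
    ... | yes x<K = x<K
    ... | no  x≮K = ⊥-elim (<⇒≱ (≤-<-trans (m≤m+n (m x) _) lt) (increasing-mono (≮⇒≥ x≮K)))

  ur⇒sumCount≡1 : ∀ K {j} → j < m K → InUR m j → sumCount (prefix m K) j ≡ 1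
  ur⇒sumCount≡1 K {j} j<mK (I , si , sum≡ , unique) = ≤-antisym ≤1 (rep⇒sumCount-pos K m I rep)
    where
    rep : Rep m K j I
    rep = si , subsetSum<⇒indices< K I (subst (_< m K) (sym sum≡) j<mK) , sum≡
    ≤1 : sumCount (prefix m K) j ≤ 1
    ≤1 with sumCount (prefix m K) j ≤? 1
    ... | yes ≤1 = ≤1
    ... | no  ≰1 with 2≤sumCount⇒distinct-reps K m (≰⇒> ≰1)
    ...   | I₁ , I₂ , (si₁ , _ , sum₁) , (si₂ , _ , sum₂) , I₁≢I₂ =
      ⊥-elim (I₁≢I₂ (trans (unique I₁ si₁ sum₁) (sym (unique I₂ si₂ sum₂))))

  sumCount≡1⇒ur : ∀ K {j} → j < m K → sumCount (prefix m K) j ≡ 1 → InUR m j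
  sumCount≡1⇒ur K {j} j<mK unique with sumCount-pos⇒rep K m (≤-reflexive (sym unique))
  ... | I , rep@(si , _ , sum≡) = I , si , sum≡ , λ J sJ sumJ →
    sumCount≤1⇒rep-unique K m J I (≤-reflexive unique)
      (sJ , subsetSum<⇒indices< K J (subst (_< m K) (sym sumJ) j<mK) , sumJ) rep

Step : ℕ → ℕ → Set
Step a x = (a < x) × (x ≤ 2 * a)

tchain-∷ʳ : ∀ a l {x} → TChain a l → Step (lastOr a l) x → TChain a (l ++ [ x ])
tchain-∷ʳ a []      _                  (a<x , x≤) = a<x , x≤ , _
tchain-∷ʳ a (b ∷ l) (a<b , b≤ , chain) step       = a<b , b≤ , tchain-∷ʳ b l chain step

tchain-∷ʳ⁻ : ∀ a l {x} → TChain a (l ++ [ x ]) → TChain a l × Step (lastOr a l) x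
tchain-∷ʳ⁻ a []      (a<x , x≤ , _)     = _ , a<x , x≤
tchain-∷ʳ⁻ a (b ∷ l) (a<b , b≤ , chain) with tchain-∷ʳ⁻ b l chain
... | chain′ , step = (a<b , b≤ , chain′) , step

isTournament-∷ʳ : ∀ {s x} → IsTournament s → Step (last s) x → IsTournament (s ++ [ x ])
isTournament-∷ʳ {a ∷ l} (a≡1 , chain) step = a≡1 , tchain-∷ʳ a l chain step

isTournament-∷ʳ⁻ : ∀ {s x} → s ≢ [] → IsTournament (s ++ [ x ]) → IsTournament s × Step (last s) x
isTournament-∷ʳ⁻ {[]}    s≢[] _             = ⊥-elim (s≢[] refl)
isTournament-∷ʳ⁻ {a ∷ l} _    (a≡1 , chain) with tchain-∷ʳ⁻ a l chain
... | chain′ , step = (a≡1 , chain′) , step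

isTournament-ind : (P : List ℕ → Set) → P [ 1 ] →
                   (∀ {s x} → s ≢ [] → IsTournament s → Step (last s) x → P s → P (s ++ [ x ])) →
                   ∀ {s} → IsTournament s → P s
isTournament-ind P P-root P-child {s} ts = go s (reverseView s) ts
  where
  go : ∀ s → Reverse s → IsTournament s → P s
  go .[]                       []                              ()
  go .([] ++ [ x ])            (.[] ∶ [] ∶ʳ x)                  (refl , _) = P-root
  go .((s ++ [ y ]) ++ [ x ]) (.(s ++ [ y ]) ∶ (s ∶ rs ∶ʳ y) ∶ʳ x) ts         =
    P-child (∷ʳ≢[] s y) ts′ step (go (s ++ [ y ]) (s ∶ rs ∶ʳ y) ts′)
    where
    ts′ = proj₁ (isTournament-∷ʳ⁻ (∷ʳ≢[] s y) ts)
    step = proj₂ (isTournament-∷ʳ⁻ (∷ʳ≢[] s y) ts)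

isTournamentInf⇒prefixes : ∀ {t} → IsTournamentInf t → ∀ n → IsTournament (prefix t (suc n))
isTournamentInf⇒prefixes (t0≡1 , _) zero = t0≡1 , _
isTournamentInf⇒prefixes {t} T@(_ , steps) (suc n) = subst IsTournament (sym (prefix-∷ʳ t (suc n)))
  (isTournament-∷ʳ (isTournamentInf⇒prefixes T n) (subst (λ a → Step a (t (suc n))) (sym (last-prefix t n)) (steps n)))

prefixes⇒isTournamentInf : ∀ {t} → (∀ n → IsTournament (prefix t (suc n))) → IsTournamentInf t
prefixes⇒isTournamentInf {t} prefixes = proj₁ (prefixes 0) , step
  where
  step : ∀ i → Step (t i) (t (suc i))
  step i = subst (λ a → Step a (t (suc i))) (last-prefix t i)
    (proj₂ (isTournament-∷ʳ⁻ (prefix-suc≢[] t i) (subst IsTournament (prefix-∷ʳ t (suc i)) (prefixes (suc i)))))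

step-offset : ∀ {a i} → i < a → Step a (suc (a + i))
step-offset {a} {i} i<a =
  s≤s (m≤m+n a i) , subst (suc (a + i) ≤_) (cong (a +_) (sym (+-identityʳ a))) (+-monoʳ-< a i<a)

step-offset⁻ : ∀ {a x} → Step a x → (x ∸ suc a < a) × (suc (a + (x ∸ suc a)) ≡ x)
step-offset⁻ {a} {x} (a<x , x≤) = +-cancelˡ-< (suc a) _ _ (subst (_< suc a + a) (sym x≡) (s≤s x≤a+a)) , x≡
  where
  x≡ : suc (a + (x ∸ suc a)) ≡ x
  x≡ = m+[n∸m]≡n a<x
  x≤a+a : x ≤ a + a
  x≤a+a = subst (x ≤_) (cong (a +_) (+-identityʳ a)) x≤

isTournament-nonempty : ∀ {s} → IsTournament s → s ≢ []
isTournament-nonempty {_ ∷ _} _ ()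

-- The Meeussen tree

record Admissible (w : List ℕ) (j : ℕ) : Set where
  constructor admissible
  field
    last≤    : last w ≤ j
    isUnique : sumCount w j ≡ 1

-- Completeness of r(M) is automatic: an admissible j is at most sum w, so the new term is at most sum w + 1.
data Meeussen : List ℕ → Set where
  root  : Meeussen [ 1 ]
  child : ∀ {w j} → Meeussen w → Admissible w j → Meeussen (w ++ [ suc j ])

meeussen-nonempty : ∀ {w} → Meeussen w → w ≢ []
meeussen-nonempty root            ()
meeussen-nonempty (child {w} _ _) = ∷ʳ≢[] w _

admissible⇒≤sum : ∀ {w j} → Admissible w j → j ≤ sum w
admissible⇒≤sum {w} (admissible _ unique) = sumCount-pos⇒≤sum w (≤-reflexive (sym unique))

meeussen-∷ʳ⁻ : ∀ {w y} → Meeussen (w ++ [ y ]) → w ≢ [] →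
               Meeussen w × Σ ℕ λ j → (y ≡ suc j) × Admissible w j
meeussen-∷ʳ⁻ {w} {y} m w≢[] = invert m refl
  where
  invert : ∀ {z} → Meeussen z → z ≡ w ++ [ y ] → Meeussen w × Σ ℕ λ j → (y ≡ suc j) × Admissible w j
  invert root                       eq = ⊥-elim (w≢[] (sym (∷ʳ-injectiveˡ [] w eq)))
  invert (child {v} {j} mv adm) eq with ∷ʳ-injective v w eq
  ... | refl , refl = mv , j , refl , adm

meeussen-prefix : ∀ {w} u → Meeussen (w ++ u) → w ≢ [] → Meeussen w
meeussen-prefix {w} u m w≢[] = go u (reverseView u) m
  where
  go : ∀ u → Reverse u → Meeussen (w ++ u) → Meeussen w
  go .[]           []              m = subst Meeussen (++-identityʳ w) m
  go .(u ++ [ x ]) (u ∶ ru ∶ʳ x) m =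
    go u ru (proj₁ (meeussen-∷ʳ⁻ (subst Meeussen (sym (++-assoc w u [ x ])) m)
                                 (λ wu≡[] → w≢[] (++-conicalˡ w u wu≡[]))))

meeussen-sumCount-0 : ∀ {w} → Meeussen w → sumCount w 0 ≡ 1
meeussen-sumCount-0 root                = refl
meeussen-sumCount-0 (child {w} {j} m _) = trans (sumCount-∷ʳ w (suc j) 0) (cong (_+ 0) (meeussen-sumCount-0 m))

meeussen-last≤sum : ∀ {w} → Meeussen w → last w ≤ sum w
meeussen-last≤sum root                = ≤-refl
meeussen-last≤sum (child {w} {j} _ _) =
  subst₂ _≤_ (sym (last-∷ʳ w (suc j))) (sym (sum-∷ʳ w (suc j))) (m≤n+m (suc j) (sum w))

meeussen-complete : ∀ {w} → Meeussen w → ∀ {k} → k ≤ sum w → 0 < sumCount w k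
meeussen-complete root {zero}        _           = s≤s z≤n
meeussen-complete root {suc zero}    _           = s≤s z≤n
meeussen-complete root {suc (suc k)} (s≤s ())
meeussen-complete (child {w} {j} m adm) {k} k≤sum =
  ≤-trans positive (≤-reflexive (sym (sumCount-∷ʳ w (suc j) k)))
  where
  positive : 0 < sumCount w k + shift (suc j) (sumCount w) k
  positive with k ≤? sum w
  ... | yes k≤s = ≤-trans (meeussen-complete m k≤s) (m≤m+n _ _)
  ... | no  k≰s with m≤n⇒∃[o]m+o≡n (≤-trans (s≤s (admissible⇒≤sum adm)) (≰⇒> k≰s))
  ...   | d , refl = ≤-trans (subst (0 <_) (sym (shift-+ (suc j) _ d)) (meeussen-complete m d≤s)) (m≤n+m _ _)
    where
    d≤s : d ≤ sum w
    d≤s = +-cancelˡ-≤ (suc j) d (sum w)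
            (subst (suc j + d ≤_) (trans (sum-∷ʳ w (suc j)) (+-comm (sum w) (suc j))) k≤sum)

meeussen-head : ∀ {v} → Meeussen v → Σ (List ℕ) λ v′ → v ≡ 1 ∷ v′
meeussen-head root                = [] , refl
meeussen-head (child {j = j} m _) with meeussen-head m
... | v′ , refl = v′ ++ [ suc j ] , refl

isUnique? : ∀ w → Decidable (λ i → sumCount w i ≡ 1)
isUnique? w i = sumCount w i ≟ 1

uniqueBelow : List ℕ → ℕ → ℕ
uniqueBelow w = count (isUnique? w)

-- The number of children of w, and also the last term of the tournament sequence corresponding to w.
degree : List ℕ → ℕ
degree w = uniqueBelow w (last w)

uniqueBelow-∷ʳ : ∀ w a {k} → k ≤ a → uniqueBelow (w ++ [ a ]) k ≡ uniqueBelow w k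
uniqueBelow-∷ʳ w a {k} k≤a =
  count-cong (isUnique? (w ++ [ a ])) (isUnique? w) k λ i i<k → trans (sym (same i<k)) , trans (same i<k)
  where
  same : ∀ {i} → i < k → sumCount (w ++ [ a ]) i ≡ sumCount w i
  same {i} i<k = trans (sumCount-∷ʳ w a i)
                   (trans (cong (sumCount w i +_) (shift-< a _ (<-≤-trans i<k k≤a))) (+-identityʳ _))

degree-∷ʳ : ∀ w a → degree (w ++ [ a ]) ≡ uniqueBelow w a
degree-∷ʳ w a = trans (cong (uniqueBelow (w ++ [ a ])) (last-∷ʳ w a)) (uniqueBelow-∷ʳ w a ≤-refl)

2≤sumCount-∷ʳ : ∀ {w} a {i} → Meeussen w → a + i ≤ sum w → 2 ≤ sumCount (w ++ [ a ]) (a + i)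
2≤sumCount-∷ʳ {w} a {i} m a+i≤s = subst (2 ≤_) (sym (sumCount-∷ʳ w a (a + i)))
  (+-mono-≤ (meeussen-complete m a+i≤s)
            (subst (0 <_) (sym (shift-+ a _ i)) (meeussen-complete m (≤-trans (m≤n+m i a) a+i≤s))))

-- Values in [a, sum w] are represented both with and without the new last term a, so by the
-- symmetry of sumCount the unique values of w ++ [ a ] lie in [0, a) or in its mirror image.
uniqueBelow-double : ∀ {w} → Meeussen w → uniqueBelow w (suc (sum w)) ≡ 2 * degree w
uniqueBelow-double root = refl
uniqueBelow-double (child {w} {j} m adm) = begin
  U (suc (sum W))                                 ≡⟨ cong U total ⟩
  U (a + suc (sum w))                             ≡⟨ count-+ P? a (suc (sum w)) ⟩
  U a + count (λ i → P? (a + i)) (suc (sum w))    ≡⟨ cong (U a +_) (count-reverse (λ i → P? (a + i)) P? _ mirror) ⟩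
  U a + U (suc (sum w))                           ≡⟨ cong (U a +_) middle ⟩
  U a + U a                                       ≡⟨ cong (U a +_) (+-identityʳ (U a)) ⟨
  2 * U a                                         ≡⟨ cong (λ k → 2 * U k) (last-∷ʳ w a) ⟨
  2 * degree W                                    ∎
  where
  open ≡-Reasoning
  a = suc j
  W = w ++ [ a ]
  P? = isUnique? W
  U = uniqueBelow W
  total : suc (sum W) ≡ a + suc (sum w)
  total = trans (cong suc (trans (sum-∷ʳ w a) (+-comm (sum w) a))) (sym (+-suc a (sum w)))
  mirror : ∀ i k → suc (i + k) ≡ suc (sum w) → (sumCount W (a + i) ≡ 1) ⟺ (sumCount W k ≡ 1)
  mirror i k eq = trans (sym same) , trans same
    where
    same = sumCount-sym W (trans (+-assoc a i k) (trans (cong (a +_) (suc-injective eq))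
                                 (trans (+-comm a (sum w)) (sym (sum-∷ʳ w a)))))
  middle : U (suc (sum w)) ≡ U a
  middle with m≤n⇒∃[o]m+o≡n (s≤s (admissible⇒≤sum adm))
  ... | e , a+e≡ = begin
    U (suc (sum w))                   ≡⟨ cong U a+e≡ ⟨
    U (a + e)                         ≡⟨ count-+ P? a e ⟩
    U a + count (λ i → P? (a + i)) e  ≡⟨ cong (U a +_) (count-none (λ i → P? (a + i)) e ambiguous) ⟩
    U a + 0                           ≡⟨ +-identityʳ _ ⟩
    U a                               ∎
    where
    ambiguous : ∀ i → i < e → sumCount W (a + i) ≢ 1
    ambiguous i i<e unique = <-irrefl (sym unique) (2≤sumCount-∷ʳ a m (≤-pred a+i<1+s))
      where
      a+i<1+s : a + i < suc (sum w)
      a+i<1+s = subst (a + i <_) a+e≡ (+-monoʳ-< a i<e)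

-- The child of w corresponding to the child x of a tournament node with last term degree w.
next : List ℕ → ℕ → ℕ
next w x = search (uniqueBelow w) x 0 (suc (sum w))

module _ {w} (m : Meeussen w) where

  next-least : ∀ {x} → x ≤ 2 * degree w → Least (uniqueBelow w) x (next w x)
  next-least x≤ = search-least _ _ 0 _ (λ _ ()) (subst (_ ≤_) (sym (uniqueBelow-double m)) x≤)

  next-admissible : ∀ {x} → Step (degree w) x →
                    Σ ℕ λ j → (next w x ≡ suc j) × Admissible w j × (uniqueBelow w (suc j) ≡ x)
  next-admissible {x} (deg<x , x≤) with next w x | next-least x≤
  ... | zero  | x≤U0 , _ = ⊥-elim (<⇒≱ (≤-<-trans z≤n deg<x) x≤U0)
  ... | suc j | x≤U , below =
    j , refl , admissible last≤j (count-increase (isUnique? w) (<-≤-trans (below j ≤-refl) x≤U)) , U≡x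
    where
    U≡x : uniqueBelow w (suc j) ≡ x
    U≡x = ≤-antisym (≤-trans (proj₂ (count-step (isUnique? w) j)) (below j ≤-refl)) x≤U
    last≤j : last w ≤ j
    last≤j with last w ≤? j
    ... | yes p = p
    ... | no  p = ⊥-elim (<⇒≱ deg<x (subst (_≤ degree w) U≡x (count-mono (isUnique? w) (≰⇒> p))))

  uniqueBelow-admissible : ∀ {j} → Admissible w j → Step (degree w) (uniqueBelow w (suc j))
  uniqueBelow-admissible {j} adm@(admissible last≤j unique) = degree< , ≤2degree
    where
    degree< : degree w < uniqueBelow w (suc j)
    degree< = subst (degree w <_) (sym (count-yes (isUnique? w) unique))
                (s≤s (count-mono (isUnique? w) last≤j))
    ≤2degree : uniqueBelow w (suc j) ≤ 2 * degree w
    ≤2degree = subst (uniqueBelow w (suc j) ≤_) (uniqueBelow-double m)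
                 (count-mono (isUnique? w) (s≤s (admissible⇒≤sum adm)))

  next-uniqueBelow : ∀ {j} → Admissible w j → next w (uniqueBelow w (suc j)) ≡ suc j
  next-uniqueBelow {j} adm@(admissible _ unique) =
    sym (least-unique least (next-least (proj₂ (uniqueBelow-admissible adm))))
    where
    least : Least (uniqueBelow w) (uniqueBelow w (suc j)) (suc j)
    least = ≤-refl , λ i i<1+j → subst (_ <_) (sym (count-yes (isUnique? w) unique))
                                   (s≤s (count-mono (isUnique? w) (≤-pred i<1+j)))

  next-< : ∀ {x x′} → Step (degree w) x → x < x′ → x′ ≤ 2 * degree w → next w x < next w x′
  next-< {x} {x′} sx x<x′ x′≤ with next-admissible sx
  ... | j , next≡ , _ , U≡x = ≰⇒> λ next≤ → <⇒≱ x<x′ (begin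
    x′                          ≤⟨ proj₁ (next-least x′≤) ⟩
    uniqueBelow w (next w x′)   ≤⟨ count-mono (isUnique? w) next≤ ⟩
    uniqueBelow w (next w x)    ≡⟨ cong (uniqueBelow w) next≡ ⟩
    uniqueBelow w (suc j)       ≡⟨ U≡x ⟩
    x                           ∎)
    where open ≤-Reasoning

  next-<⁻ : ∀ {x x′} → Step (degree w) x → Step (degree w) x′ → next w x < next w x′ → x < x′
  next-<⁻ {x} {x′} sx sx′ lt with <-cmp x x′
  ... | tri< x<x′ _ _ = x<x′
  ... | tri≈ _ refl _ = ⊥-elim (<-irrefl refl lt)
  ... | tri> _ _ x′<x = ⊥-elim (<-asym lt (next-< sx′ x′<x (proj₂ sx)))

  next-injective : ∀ {x x′} → Step (degree w) x → Step (degree w) x′ → next w x ≡ next w x′ → x ≡ x′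
  next-injective {x} {x′} sx sx′ eq with <-cmp x x′
  ... | tri< x<x′ _ _ = ⊥-elim (<-irrefl eq (next-< sx x<x′ (proj₂ sx′)))
  ... | tri≈ _ x≡x′ _ = x≡x′
  ... | tri> _ _ x′<x = ⊥-elim (<-irrefl (sym eq) (next-< sx′ x′<x (proj₂ sx)))

isMeeussenInf⇒prefixes : ∀ {m} → IsMeeussenInf m → ∀ n → Meeussen (prefix m (suc n))
isMeeussenInf⇒prefixes (m0≡1 , _ , _ , _) zero = subst (λ a → Meeussen [ a ]) (sym m0≡1) root
isMeeussenInf⇒prefixes {m} M@(_ , incr , _ , ur) (suc n) =
  subst Meeussen (sym (prefix-∷ʳ m (suc n))) (subst (λ y → Meeussen (prefix m (suc n) ++ [ y ])) m≡ extended)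
  where
  j = m (suc n) ∸ 1
  m≡ : suc j ≡ m (suc n)
  m≡ = m+[n∸m]≡n (≤-trans (s≤s z≤n) (incr n))
  extended : Meeussen (prefix m (suc n) ++ [ suc j ])
  extended = child (isMeeussenInf⇒prefixes M n)
    (admissible (subst (_≤ j) (sym (last-prefix m n)) (s≤s⁻¹ (subst (m n <_) (sym m≡) (incr n))))
                (ur⇒sumCount≡1 incr (suc n) (subst (j <_) m≡ ≤-refl) (ur (suc n))))

module _ {m : ℕ → ℕ} (prefixes : ∀ n → Meeussen (prefix m (suc n))) where

  prefix-step : ∀ i → Σ ℕ λ j → (m (suc i) ≡ suc j) × Admissible (prefix m (suc i)) j
  prefix-step i = proj₂ (meeussen-∷ʳ⁻ (subst Meeussen (prefix-∷ʳ m (suc i)) (prefixes (suc i)))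
                                      (prefix-suc≢[] m i))

  prefixes⇒isMeeussenInf : IsMeeussenInf m
  prefixes⇒isMeeussenInf = m0≡1 , incr , complete , unique
    where
    m0≡1 : m 0 ≡ 1
    m0≡1 = proj₁ (∷-injective (proj₂ (meeussen-head (prefixes 0))))
    incr : Increasing m
    incr i with prefix-step i
    ... | j , m≡ , admissible last≤j _ = subst (m i <_) (sym m≡) (s≤s (subst (_≤ j) (last-prefix m i) last≤j))
    1+i≤m : ∀ i → suc i ≤ m i
    1+i≤m zero    = ≤-reflexive (sym m0≡1)
    1+i≤m (suc i) = ≤-trans (s≤s (1+i≤m i)) (incr i)
    n≤sum : ∀ n → n ≤ sum (prefix m (suc n))
    n≤sum n = ≤-trans (≤-trans (n≤1+n n) (1+i≤m n))
                      (subst (_≤ sum (prefix m (suc n))) (last-prefix m n) (meeussen-last≤sum (prefixes n)))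
    complete : ∀ n → InR m n
    complete n with sumCount-pos⇒rep (suc n) m (meeussen-complete (prefixes n) (n≤sum n))
    ... | I , si , _ , sum≡ = I , si , sum≡
    unique-below : ∀ i → sumCount (prefix m i) (m i ∸ 1) ≡ 1
    unique-below zero    rewrite m0≡1 = refl
    unique-below (suc i) with prefix-step i
    ... | j , m≡ , admissible _ unique rewrite m≡ = unique
    unique : ∀ i → InUR m (m i ∸ 1)
    unique i = sumCount≡1⇒ur incr i (∸-monoʳ-< {m i} {1} {0} (s≤s z≤n) (≤-trans (s≤s z≤n) (1+i≤m i)))
                 (unique-below i)

isMeeussen⇒meeussen : ∀ {v} → IsMeeussen v → Meeussen v
isMeeussen⇒meeussen {v} (1≤len , m , M , v≡) = subst Meeussen (sym v≡) (prefixes (length v) 1≤len)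
  where
  prefixes : ∀ n → 1 ≤ n → Meeussen (prefix m n)
  prefixes (suc n) _ = isMeeussenInf⇒prefixes M n

grow : List ℕ → List ℕ
grow w = w ++ [ suc (sum w) ]

growN : List ℕ → ℕ → List ℕ
growN w zero    = w
growN w (suc n) = growN (grow w) n

-- sum w is represented only by all of w, just as 0 is only by none of it.
meeussen-grow : ∀ {w} → Meeussen w → Meeussen (grow w)
meeussen-grow {w} m =
  child m (admissible (meeussen-last≤sum m) (trans (sumCount-sym w (+-identityʳ (sum w))) (meeussen-sumCount-0 m)))

meeussen-growN : ∀ {w} → Meeussen w → ∀ n → Meeussen (growN w n)
meeussen-growN m zero    = m
meeussen-growN m (suc n) = meeussen-growN (meeussen-grow m) n

growN-++ : ∀ w n → Σ (List ℕ) λ u → growN w n ≡ w ++ u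
growN-++ w zero    = [] , sym (++-identityʳ w)
growN-++ w (suc n) with growN-++ (grow w) n
... | u , eq = suc (sum w) ∷ u , trans eq (++-assoc w [ suc (sum w) ] u)

length-growN : ∀ w n → length (growN w n) ≡ length w + n
length-growN w zero    = sym (+-identityʳ _)
length-growN w (suc n) = trans (length-growN (grow w) n)
  (trans (cong (_+ n) (length-++ w)) (+-assoc (length w) 1 n))

growN-+ : ∀ w a b → growN w (a + b) ≡ growN (growN w a) b
growN-+ w zero    b = refl
growN-+ w (suc a) b = growN-+ (grow w) a b

extension : List ℕ → ℕ → ℕ
extension w i = at (growN w (suc i)) i

extension-at : ∀ w {i k} → i < k → extension w i ≡ at (growN w k) i
extension-at w {i} i<k with m≤n⇒∃[o]m+o≡n i<k
... | d , refl with growN-++ (growN w (suc i)) d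
... | u , eq = sym (begin
  at (growN w (suc i + d)) i            ≡⟨ cong (λ l → at l i) (trans (growN-+ w (suc i) d) eq) ⟩
  at (growN w (suc i) ++ u) i           ≡⟨ at-++ (growN w (suc i)) u i<len ⟩
  at (growN w (suc i)) i                ∎)
  where
  open ≡-Reasoning
  i<len : i < length (growN w (suc i))
  i<len = subst (i <_) (sym (length-growN w (suc i))) (≤-trans (n<1+n i) (m≤n+m (suc i) (length w)))

meeussen⇒isMeeussen : ∀ {v} → Meeussen v → IsMeeussen v
meeussen⇒isMeeussen {v} m = 1≤len , extension v , prefixes⇒isMeeussenInf prefixes , sym prefix≡v
  where
  1≤len : 1 ≤ length v
  1≤len with meeussen-head m
  ... | _ , refl = s≤s z≤n
  prefix≡take : ∀ n → prefix (extension v) n ≡ take n (growN v n)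
  prefix≡take n = prefix-take n (growN v n) (subst (n ≤_) (sym (length-growN v n)) (m≤n+m n (length v)))
                              (λ i i<n → extension-at v i<n)
  prefixes : ∀ n → Meeussen (prefix (extension v) (suc n))
  prefixes n = subst Meeussen (sym (prefix≡take (suc n)))
    (meeussen-prefix (drop (suc n) E) (subst Meeussen (sym (take++drop≡id (suc n) E)) (meeussen-growN m (suc n)))
                     (subst (_≢ []) (prefix≡take (suc n)) (prefix-suc≢[] _ n)))
    where E = growN v (suc n)
  prefix≡v : prefix (extension v) (length v) ≡ v
  prefix≡v = trans (prefix-take (length v) v ≤-refl extension-agrees) (take-all (length v) v ≤-refl)
    where
    extension-agrees : ∀ i → i < length v → extension v i ≡ at v i
    extension-agrees i i<len with growN-++ v (suc i)
    ... | u , eq = trans (cong (λ l → at l i) eq) (at-++ v u i<len)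

-- The isomorphism φ

φ-from : List ℕ → List ℕ → List ℕ
φ-from w []      = []
φ-from w (x ∷ s) = next w x ∷ φ-from (w ++ [ next w x ]) s

-- next [] 1 computes to 1, so φ (1 ∷ s) reduces to 1 ∷ φ-from [ 1 ] s.
φ : List ℕ → List ℕ
φ = φ-from []

φ⁻¹-from : List ℕ → List ℕ → List ℕ
φ⁻¹-from w []      = []
φ⁻¹-from w (y ∷ v) = degree (w ++ [ y ]) ∷ φ⁻¹-from (w ++ [ y ]) v

φ⁻¹ : List ℕ → List ℕ
φ⁻¹ = φ⁻¹-from []

φ-from-length : ∀ w s → length (φ-from w s) ≡ length s
φ-from-length w []      = refl
φ-from-length w (x ∷ s) = cong suc (φ-from-length _ s)

φ-from-∷ʳ : ∀ w s x → φ-from w (s ++ [ x ]) ≡ φ-from w s ++ [ next (w ++ φ-from w s) x ]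
φ-from-∷ʳ w []      x = cong (λ v → [ next v x ]) (sym (++-identityʳ w))
φ-from-∷ʳ w (y ∷ s) x = cong (next w y ∷_) (trans (φ-from-∷ʳ (w ++ [ next w y ]) s x)
  (cong (λ v → φ-from (w ++ [ next w y ]) s ++ [ next v x ]) (++-assoc w [ next w y ] _)))

φ⁻¹-from-∷ʳ : ∀ w v y → φ⁻¹-from w (v ++ [ y ]) ≡ φ⁻¹-from w v ++ [ degree ((w ++ v) ++ [ y ]) ]
φ⁻¹-from-∷ʳ w []      y = cong (λ u → [ degree (u ++ [ y ]) ]) (sym (++-identityʳ w))
φ⁻¹-from-∷ʳ w (z ∷ v) y = cong (degree (w ++ [ z ]) ∷_) (trans (φ⁻¹-from-∷ʳ (w ++ [ z ]) v y)
  (cong (λ u → φ⁻¹-from (w ++ [ z ]) v ++ [ degree (u ++ [ y ]) ]) (++-assoc w [ z ] v)))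

next-child : ∀ {w x} → Meeussen w → Step (degree w) x →
             Meeussen (w ++ [ next w x ]) × (degree (w ++ [ next w x ]) ≡ x)
next-child {w} m sx with next-admissible m sx
... | j , next≡ , adm , U≡x rewrite next≡ = child m adm , trans (degree-∷ʳ w (suc j)) U≡x

φ-from-meeussen : ∀ {w} s → Meeussen w → TChain (degree w) s →
                  Meeussen (w ++ φ-from w s) × (degree (w ++ φ-from w s) ≡ lastOr (degree w) s)
φ-from-meeussen {w} []      m _ = subst Meeussen (sym (++-identityʳ w)) m , cong degree (++-identityʳ w)
φ-from-meeussen {w} (x ∷ s) m (deg<x , x≤ , chain) with next-child m (deg<x , x≤)
... | m′ , deg≡x with φ-from-meeussen s m′ (subst (λ a → TChain a s) (sym deg≡x) chain)
... | m″ , deg″ rewrite ++-assoc w [ next w x ] (φ-from (w ++ [ next w x ]) s) =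
  m″ , trans deg″ (cong (λ a → lastOr a s) deg≡x)

φ⁻¹-φ-from : ∀ {w} s → Meeussen w → TChain (degree w) s → φ⁻¹-from w (φ-from w s) ≡ s
φ⁻¹-φ-from []      m _ = refl
φ⁻¹-φ-from (x ∷ s) m (deg<x , x≤ , chain) with next-child m (deg<x , x≤)
... | m′ , deg≡x = cong₂ _∷_ deg≡x (φ⁻¹-φ-from s m′ (subst (λ a → TChain a s) (sym deg≡x) chain))

φ-φ⁻¹-from : ∀ {w} v → Meeussen w → Meeussen (w ++ v) →
             TChain (degree w) (φ⁻¹-from w v) × (φ-from w (φ⁻¹-from w v) ≡ v)
φ-φ⁻¹-from         []      _ _   = _ , refl
φ-φ⁻¹-from {w} (y ∷ v) m mwv
  with meeussen-∷ʳ⁻ (meeussen-prefix v (subst Meeussen (sym (++-assoc w [ y ] v)) mwv) (∷ʳ≢[] w y))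
                    (meeussen-nonempty m)
... | _ , j , refl , adm with φ-φ⁻¹-from v (child m adm) (subst Meeussen (sym (++-assoc w [ suc j ] v)) mwv)
... | chain , φφ⁻¹ = (deg< , ≤2deg , chain) , cong₂ _∷_ next≡ φφ⁻¹′
  where
  deg≡ : degree (w ++ [ suc j ]) ≡ uniqueBelow w (suc j)
  deg≡ = degree-∷ʳ w (suc j)
  deg< = subst (degree w <_) (sym deg≡) (proj₁ (uniqueBelow-admissible m adm))
  ≤2deg = subst (_≤ 2 * degree w) (sym deg≡) (proj₂ (uniqueBelow-admissible m adm))
  next≡ : next w (degree (w ++ [ suc j ])) ≡ suc j
  next≡ = trans (cong (next w) deg≡) (next-uniqueBelow m adm)
  φφ⁻¹′ = subst (λ y → φ-from (w ++ [ y ]) (φ⁻¹-from (w ++ [ suc j ]) v) ≡ v) (sym next≡) φφ⁻¹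

φ-from-<lex : ∀ {w} s t → Meeussen w → TChain (degree w) s → TChain (degree w) t →
              s <lex t → φ-from w s <lex φ-from w t
φ-from-<lex []      (_ ∷ _) m _ _ []<∷ = []<∷
φ-from-<lex (x ∷ _) (y ∷ _) m (deg<x , x≤ , _) (_ , y≤ , _) (head< x<y) = head< (next-< m (deg<x , x≤) x<y y≤)
φ-from-<lex (x ∷ s) (x ∷ t) m (deg<x , x≤ , cs) (_ , _ , ct) (tail< s<t) with next-child m (deg<x , x≤)
... | m′ , deg≡x = tail< (φ-from-<lex s t m′ (subst (λ a → TChain a s) (sym deg≡x) cs)
                                              (subst (λ a → TChain a t) (sym deg≡x) ct) s<t)

φ-from-<lex⁻ : ∀ {w} s t → Meeussen w → TChain (degree w) s → TChain (degree w) t →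
               φ-from w s <lex φ-from w t → s <lex t
φ-from-<lex⁻ []      (_ ∷ _) m _ _ _ = []<∷
φ-from-<lex⁻ (x ∷ s) (y ∷ t) m (deg<x , x≤ , cs) (deg<y , y≤ , ct) lt with ∷-<lex⁻ lt
... | inj₁ next< = head< (next-<⁻ m (deg<x , x≤) (deg<y , y≤) next<)
... | inj₂ (next≡ , lt′) with next-injective m (deg<x , x≤) (deg<y , y≤) next≡
...   | refl with next-child m (deg<x , x≤)
...     | m′ , deg≡x = tail< (φ-from-<lex⁻ s t m′ (subst (λ a → TChain a s) (sym deg≡x) cs)
                                                 (subst (λ a → TChain a t) (sym deg≡x) ct) lt′)

φ-meeussen : ∀ s → IsTournament s → Meeussen (φ s) × (degree (φ s) ≡ last s)
φ-meeussen (1 ∷ s) (refl , chain) = φ-from-meeussen s root chain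

φ⁻¹-φ : ∀ s → IsTournament s → φ⁻¹ (φ s) ≡ s
φ⁻¹-φ (1 ∷ s) (refl , chain) = cong (1 ∷_) (φ⁻¹-φ-from s root chain)

φ-φ⁻¹ : ∀ {v} → Meeussen v → IsTournament (φ⁻¹ v) × (φ (φ⁻¹ v) ≡ v)
φ-φ⁻¹ m with meeussen-head m
... | v′ , refl with φ-φ⁻¹-from v′ root m
... | chain , φφ⁻¹ = (refl , chain) , cong (1 ∷_) φφ⁻¹

φ-injective : ∀ s t → IsTournament s → IsTournament t → φ s ≡ φ t → s ≡ t
φ-injective s t ts tt eq = begin
  s           ≡⟨ φ⁻¹-φ s ts ⟨
  φ⁻¹ (φ s)   ≡⟨ cong φ⁻¹ eq ⟩
  φ⁻¹ (φ t)   ≡⟨ φ⁻¹-φ t tt ⟩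
  t           ∎
  where open ≡-Reasoning

φ-<lex : ∀ s t → IsTournament s → IsTournament t → (s <lex t) ⟺ (φ s <lex φ t)
φ-<lex (1 ∷ s) (1 ∷ t) (refl , cs) (refl , ct) = to , from
  where
  to : (1 ∷ s) <lex (1 ∷ t) → φ (1 ∷ s) <lex φ (1 ∷ t)
  to (head< (s≤s ()))
  to (tail< s<t) = tail< (φ-from-<lex s t root cs ct s<t)
  from : φ (1 ∷ s) <lex φ (1 ∷ t) → (1 ∷ s) <lex (1 ∷ t)
  from (head< (s≤s ()))
  from (tail< lt) = tail< (φ-from-<lex⁻ s t root cs ct lt)

φ-isTreeIso : IsTreeIso φ
φ-isTreeIso = record
  { maps   = λ s ts → meeussen⇒isMeeussen (proj₁ (φ-meeussen s ts))
  ; inj    = φ-injective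
  ; surj   = λ v isM → φ⁻¹ v , φ-φ⁻¹ (isMeeussen⇒meeussen isM)
  ; root   = refl
  ; parent = λ s x _ _ → next (φ s) x , φ-from-∷ʳ [] s x
  }

-- Uniqueness

module _ {ψ : List ℕ → List ℕ} (iso : IsTreeIso ψ) where
  private module I = IsTreeIso iso

  length-ψ : ∀ {s} → IsTournament s → length (ψ s) ≡ length s
  length-ψ = isTournament-ind (λ s → length (ψ s) ≡ length s) (cong length I.root) step
    where
    step : ∀ {s x} → s ≢ [] → IsTournament s → Step (last s) x →
           length (ψ s) ≡ length s → length (ψ (s ++ [ x ])) ≡ length (s ++ [ x ])
    step {s} {x} s≢[] ts st ih with I.parent s x (isTournament-∷ʳ ts st) (nonempty⇒1≤length s≢[])
    ... | y , eq = begin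
      length (ψ (s ++ [ x ]))    ≡⟨ cong length eq ⟩
      length (ψ s ++ [ y ])      ≡⟨ length-∷ʳ (ψ s) y ⟩
      suc (length (ψ s))         ≡⟨ cong suc ih ⟩
      suc (length s)             ≡⟨ length-∷ʳ s x ⟨
      length (s ++ [ x ])        ∎
      where open ≡-Reasoning

  meeussen-ψ : ∀ {s} → IsTournament s → Meeussen (ψ s)
  meeussen-ψ {s} ts = isMeeussen⇒meeussen (I.maps s ts)

  module _ {u} (tu : IsTournament u) where

    child-image : ∀ {x} → Step (last u) x →
                  Σ ℕ λ j → (ψ (u ++ [ x ]) ≡ ψ u ++ [ suc j ]) × Admissible (ψ u) j
    child-image {x} st with I.parent u x (isTournament-∷ʳ tu st) (nonempty⇒1≤length (isTournament-nonempty tu))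
    ... | y , eq with meeussen-∷ʳ⁻ (subst Meeussen eq (meeussen-ψ (isTournament-∷ʳ tu st)))
                                   (meeussen-nonempty (meeussen-ψ tu))
    ...   | _ , j , refl , adm = j , eq , adm

    child-preimage : ∀ {y} → Meeussen (ψ u ++ [ y ]) →
                     Σ ℕ λ x → Step (last u) x × (ψ (u ++ [ x ]) ≡ ψ u ++ [ y ])
    child-preimage {y} m with I.surj _ (meeussen⇒isMeeussen m)
    ... | s , ts , ψs≡ = preimage s (reverseView s) ts ψs≡
      where
      preimage : ∀ s → Reverse s → IsTournament s → ψ s ≡ ψ u ++ [ y ] →
                 Σ ℕ λ x → Step (last u) x × (ψ (u ++ [ x ]) ≡ ψ u ++ [ y ])
      preimage .[]           []              ()
      preimage .(s ++ [ x ]) (s ∶ _ ∶ʳ x) ts ψs≡ =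
        x , subst (λ v → Step (last v) x) s≡u step , subst (λ v → ψ (v ++ [ x ]) ≡ ψ u ++ [ y ]) s≡u ψs≡
        where
        length≡ : suc (length s) ≡ suc (length u)
        length≡ = begin
          suc (length s)           ≡⟨ length-∷ʳ s x ⟨
          length (s ++ [ x ])      ≡⟨ length-ψ ts ⟨
          length (ψ (s ++ [ x ]))  ≡⟨ cong length ψs≡ ⟩
          length (ψ u ++ [ y ])    ≡⟨ length-∷ʳ (ψ u) y ⟩
          suc (length (ψ u))       ≡⟨ cong suc (length-ψ tu) ⟩
          suc (length u)           ∎
          where open ≡-Reasoning
        1≤len : 1 ≤ length s
        1≤len = subst (1 ≤_) (sym (suc-injective length≡)) (nonempty⇒1≤length (isTournament-nonempty tu))
        s≢[] : s ≢ []
        s≢[] s≡[] = <⇒≱ 1≤len (≤-reflexive (cong length s≡[]))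
        step = proj₂ (isTournament-∷ʳ⁻ s≢[] ts)
        s≡u : s ≡ u
        s≡u with I.parent s x ts 1≤len
        ... | y′ , eq = I.inj s u (proj₁ (isTournament-∷ʳ⁻ s≢[] ts)) tu
                          (∷ʳ-injectiveˡ (ψ s) (ψ u) (trans (sym eq) ψs≡))

    -- ψ matches the last u children of u one-to-one with the degree (ψ u) children of ψ u.
    last≡degree-ψ : last u ≡ degree (ψ u)
    last≡degree-ψ = correspondence⇒≡ R image preimage unique-i unique-k
      where
      a = last u
      w = ψ u
      b = degree w
      mw = meeussen-ψ tu
      R : ℕ → ℕ → Set
      R i k = ψ (u ++ [ suc (a + i) ]) ≡ w ++ [ next w (suc (b + k)) ]
      image : ∀ {i} → i < a → Σ ℕ λ k → (k < b) × R i k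
      image i<a with child-image (step-offset i<a)
      ... | j , eq , adm with step-offset⁻ (uniqueBelow-admissible mw adm)
      ...   | k<b , U≡ = uniqueBelow w (suc j) ∸ suc b , k<b , trans eq (cong (λ y → w ++ [ y ]) (sym next≡))
        where next≡ = trans (cong (next w) U≡) (next-uniqueBelow mw adm)
      preimage : ∀ {k} → k < b → Σ ℕ λ i → (i < a) × R i k
      preimage {k} k<b = x ∸ suc a , proj₁ (step-offset⁻ st) ,
                         subst (λ x → ψ (u ++ [ x ]) ≡ w ++ [ y ]) (sym (proj₂ (step-offset⁻ st))) eq
        where
        y = next w (suc (b + k))
        pre = child-preimage (proj₁ (next-child mw (step-offset k<b)))
        x = proj₁ pre
        st : Step a x
        st = proj₁ (proj₂ pre)
        eq : ψ (u ++ [ x ]) ≡ w ++ [ y ]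
        eq = proj₂ (proj₂ pre)
      unique-i : ∀ {i i′ k} → i < a → i′ < a → R i k → R i′ k → i ≡ i′
      unique-i i<a i′<a eq eq′ = +-cancelˡ-≡ a _ _ (suc-injective (∷ʳ-injectiveʳ u u
        (I.inj _ _ (isTournament-∷ʳ tu (step-offset i<a)) (isTournament-∷ʳ tu (step-offset i′<a))
                   (trans eq (sym eq′)))))
      unique-k : ∀ {i k k′} → k < b → k′ < b → R i k → R i k′ → k ≡ k′
      unique-k k<b k′<b eq eq′ = +-cancelˡ-≡ b _ _ (suc-injective
        (next-injective mw (step-offset k<b) (step-offset k′<b) (∷ʳ-injectiveʳ w w (trans (sym eq) eq′))))

  -- Children of a Meeussen node have pairwise distinct degrees, so ψ has no freedom in matching children.
  ψ≡φ : ∀ {s} → IsTournament s → ψ s ≡ φ s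
  ψ≡φ = isTournament-ind (λ s → ψ s ≡ φ s) I.root step
    where
    step : ∀ {s x} → s ≢ [] → IsTournament s → Step (last s) x → ψ s ≡ φ s → ψ (s ++ [ x ]) ≡ φ (s ++ [ x ])
    step {s} {x} _ ts st ψs≡φs with child-image ts st
    ... | j , eq , adm = begin
      ψ (s ++ [ x ])                     ≡⟨ eq ⟩
      ψ s ++ [ suc j ]                   ≡⟨ cong (_++ [ suc j ]) ψs≡φs ⟩
      φ s ++ [ suc j ]                   ≡⟨ cong (λ y → φ s ++ [ y ]) next≡ ⟨
      φ s ++ [ next (φ s) x ]            ≡⟨ φ-from-∷ʳ [] s x ⟨
      φ (s ++ [ x ])                     ∎
      where
      open ≡-Reasoning
      x≡ : x ≡ uniqueBelow (φ s) (suc j)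
      x≡ = begin
        x                                  ≡⟨ last-∷ʳ s x ⟨
        last (s ++ [ x ])                  ≡⟨ last≡degree-ψ (isTournament-∷ʳ ts st) ⟩
        degree (ψ (s ++ [ x ]))            ≡⟨ cong degree (trans eq (cong (_++ [ suc j ]) ψs≡φs)) ⟩
        degree (φ s ++ [ suc j ])          ≡⟨ degree-∷ʳ (φ s) (suc j) ⟩
        uniqueBelow (φ s) (suc j)          ∎
      next≡ : next (φ s) x ≡ suc j
      next≡ = trans (cong (next (φ s)) x≡)
                    (next-uniqueBelow (proj₁ (φ-meeussen s ts)) (subst (λ v → Admissible v j) ψs≡φs adm))

-- Infinite sequences

SnocPreserving : (List ℕ → List ℕ) → Set
SnocPreserving f = (f [] ≡ []) × (∀ s x → Σ ℕ λ y → f (s ++ [ x ]) ≡ f s ++ [ y ])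

φ-snocPreserving : SnocPreserving φ
φ-snocPreserving = refl , λ s x → next (φ s) x , φ-from-∷ʳ [] s x

φ⁻¹-snocPreserving : SnocPreserving φ⁻¹
φ⁻¹-snocPreserving = refl , λ v y → degree (v ++ [ y ]) , φ⁻¹-from-∷ʳ [] v y

lift : (List ℕ → List ℕ) → (ℕ → ℕ) → ℕ → ℕ
lift f t i = last (f (prefix t (suc i)))

prefix-lift : ∀ {f} → SnocPreserving f → ∀ t n → prefix (lift f t) n ≡ f (prefix t n)
prefix-lift (f[]≡[] , _) t zero = sym f[]≡[]
prefix-lift {f} sp@(_ , f-∷ʳ) t (suc n) with f-∷ʳ (prefix t n) (t n)
... | y , eq = begin
  prefix (lift f t) (suc n)              ≡⟨ prefix-∷ʳ (lift f t) n ⟩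
  prefix (lift f t) n ++ [ lift f t n ]  ≡⟨ cong₂ (λ p z → p ++ [ z ]) (prefix-lift sp t n) lift≡y ⟩
  f (prefix t n) ++ [ y ]                ≡⟨ eq ⟨
  f (prefix t n ++ [ t n ])              ≡⟨ cong f (prefix-∷ʳ t n) ⟨
  f (prefix t (suc n))                   ∎
  where
  open ≡-Reasoning
  lift≡y : lift f t n ≡ y
  lift≡y = trans (cong (last ∘ f) (prefix-∷ʳ t n)) (trans (cong last eq) (last-∷ʳ (f (prefix t n)) y))

Φ : (ℕ → ℕ) → ℕ → ℕ
Φ = lift φ

prefix-Φ : ∀ t n → prefix (Φ t) n ≡ φ (prefix t n)
prefix-Φ = prefix-lift φ-snocPreserving

module _ {t : ℕ → ℕ} (T : IsTournamentInf t) where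

  Φ-isMeeussenInf : IsMeeussenInf (Φ t)
  Φ-isMeeussenInf = prefixes⇒isMeeussenInf λ n →
    subst Meeussen (sym (prefix-Φ t (suc n))) (proj₁ (φ-meeussen _ (isTournamentInf⇒prefixes T n)))

  module _ {t′ : ℕ → ℕ} (T′ : IsTournamentInf t′) where

    Φ-injective : (∀ i → Φ t i ≡ Φ t′ i) → ∀ i → t i ≡ t′ i
    Φ-injective Φt≗Φt′ i = begin
      t i                       ≡⟨ last-prefix t i ⟨
      last (prefix t (suc i))   ≡⟨ cong last prefix≡ ⟩
      last (prefix t′ (suc i))  ≡⟨ last-prefix t′ i ⟩
      t′ i                      ∎
      where
      open ≡-Reasoning
      φ≡ : φ (prefix t (suc i)) ≡ φ (prefix t′ (suc i))
      φ≡ = trans (sym (prefix-Φ t (suc i))) (trans (prefix-cong (suc i) (λ j _ → Φt≗Φt′ j)) (prefix-Φ t′ (suc i)))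
      prefix≡ : prefix t (suc i) ≡ prefix t′ (suc i)
      prefix≡ = φ-injective _ _ (isTournamentInf⇒prefixes T i) (isTournamentInf⇒prefixes T′ i) φ≡

    Φ-<lex : LexInf t t′ ⟺ LexInf (Φ t) (Φ t′)
    Φ-<lex = to , from
      where
      φ-<lex-prefix : ∀ n → (prefix t (suc n) <lex prefix t′ (suc n)) ⟺
                            (prefix (Φ t) (suc n) <lex prefix (Φ t′) (suc n))
      φ-<lex-prefix n rewrite prefix-Φ t (suc n) | prefix-Φ t′ (suc n) =
        φ-<lex _ _ (isTournamentInf⇒prefixes T n) (isTournamentInf⇒prefixes T′ n)
      to : LexInf t t′ → LexInf (Φ t) (Φ t′)
      to lt with LexInf⇒prefix-<lex lt
      ... | n , p<p′ = prefix-<lex⇒LexInf (suc n) (proj₁ (φ-<lex-prefix n) p<p′)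
      from : LexInf (Φ t) (Φ t′) → LexInf t t′
      from lt with LexInf⇒prefix-<lex lt
      ... | n , p<p′ = prefix-<lex⇒LexInf (suc n) (proj₂ (φ-<lex-prefix n) p<p′)

Φ-surjective : ∀ {m} → IsMeeussenInf m → Σ (ℕ → ℕ) λ t → IsTournamentInf t × (∀ i → Φ t i ≡ m i)
Φ-surjective {m} M = t , T , Φt≗m
  where
  t = lift φ⁻¹ m
  prefix-t : ∀ n → prefix t (suc n) ≡ φ⁻¹ (prefix m (suc n))
  prefix-t = prefix-lift φ⁻¹-snocPreserving m ∘ suc
  T : IsTournamentInf t
  T = prefixes⇒isTournamentInf λ n →
    subst IsTournament (sym (prefix-t n)) (proj₁ (φ-φ⁻¹ (isMeeussenInf⇒prefixes M n)))
  Φt≗m : ∀ i → Φ t i ≡ m i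
  Φt≗m i = begin
    last (φ (prefix t (suc i)))              ≡⟨ cong (last ∘ φ) (prefix-t i) ⟩
    last (φ (φ⁻¹ (prefix m (suc i))))       ≡⟨ cong last (proj₂ (φ-φ⁻¹ (isMeeussenInf⇒prefixes M i))) ⟩
    last (prefix m (suc i))                 ≡⟨ last-prefix m i ⟩
    m i                                     ∎
    where open ≡-Reasoning

Φ-isInfExtension : IsInfExtension φ Φ
Φ-isInfExtension = record
  { maps   = λ _ T → Φ-isMeeussenInf T
  ; agrees = λ t _ n → prefix-Φ t (suc n)
  ; inj    = λ _ _ T T′ → Φ-injective T T′
  ; surj   = λ _ → Φ-surjective
  ; lex    = λ _ _ T T′ → Φ-<lex T T′
  }

corollary1 : Σ (List ℕ → List ℕ) λ φ →
      IsTreeIso φ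
    × (∀ ψ → IsTreeIso ψ → ∀ s → IsTournament s → ψ s ≡ φ s)
    × (∀ s → IsTournament s → length (φ s) ≡ length s)
    × (∀ s t → IsTournament s → IsTournament t → (s <lex t) ⟺ (φ s <lex φ t))
    × Σ ((ℕ → ℕ) → (ℕ → ℕ)) (λ Φ → IsInfExtension φ Φ)
corollary1 =
    φ
  , φ-isTreeIso
  , (λ ψ iso s → ψ≡φ iso)
  , (λ s _ → φ-from-length [] s)
  , φ-<lex
  , Φ , Φ-isInfExtension
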